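{- If there exists $u\in A^*\setminus A$ with $|N(u,A)|\geq 2$ such that $n(u)$ and $n_2(u)$ both belong to $A'$ and $u$ is helpful for both $n(u)$ and $n_2(u)$, then $\{t(n(u)),u,t(n_2(u))\}$ is a local improvement of $A$.
   Context: Let $k\geq 4$ be an integer and $G=(V,E)$ a finite simple $(k+1)$-claw free graph (no vertex has $k+1$ pairwise non-adjacent neighbors) with weights $w:V\to\mathbb{Q}_{>0}$; $w(X)=\sum_{x\in X}w(x)$, $w^2(X)=\sum_{x\in X}w(x)^2$. Let $A^*$ be a maximum-weight independent set and $A$ an independent set. $N(X,A)=(X\cap A)\cup\{a\in A: a\text{ adjacent to some }x\in X\}$, $N(u,A)=N(\{u\},A)$. An independent $X$ is a local improvement of $A$ if $w^2(X)>w^2(N(X,A))$; it is claw-shaped if $|X|=1$ and $N(X,A)=\emptyset$, or some $v\in A$ is adjacent to all of $X$. Assume no claw-shaped improvement of $A$ exists. Fix $n(u)\in N(u,A)$ of maximum weight and, if $|N(u,A)|\geq2$, $n_2(u)\in N(u,A)\setminus\{n(u)\}$ of maximum weight. $\mathrm{contr}(u,v)=\max\{0,(w(u)^2-w^2(N(u,A)\setminus\{v\}))/w(v)\}$ if $v\in N(u,A)$, else $0$. The constant $\epsilon>0$ satisfies $\frac38(1+\epsilon)^2+\epsilon^2\leq\frac{11}{16}(1+\epsilon)^2+\epsilon^2\leq\frac34(1+\epsilon)^2+\epsilon^2\leq1$. Helpful: $u\in V\setminus A$ adjacent to $v\in A$ is helpful for $v$ if either (a) $v=n(u)$, $w(n(u))\leq(1+\epsilon)w(u)$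 and $w(N(u,A)\setminus\{n(u)\})\leq\epsilon w(u)$; or (b) $|N(u,A)|\geq2$, $v\in\{n(u),n_2(u)\}$, $(1+\epsilon)^{ -1}w(n(u))\leq w(n_2(u))\leq w(n(u))\leq(1+\epsilon)w(u)$ and $w(N(u,A)\setminus\{n(u),n_2(u)\})\leq\epsilon w(u)$. $u\in A^*$ and $v\in A$ are special neighbors if $v=n(u)$, $u$ is not helpful for $v$ and $\mathrm{contr}(u,v)>\frac58w(v)$. $A'$ is the set of vertices in $A\setminus A^*$ having at least one special neighbor; each $v\in A$ has at most one special neighbor, and for $v\in A'$ it is denoted $t(v)$. -}

module Defs where

open import Data.Nat as ℕ using (ℕ; zero; suc)
open import Data.Bool using (Bool; true; false; _∧_; _∨_; if_then_else_)
open import Data.Fin using (Fin)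
import Data.Fin as Fin
open import Data.Fin.Subset
  using (Subset; _∈_; _∉_; ⁅_⁆; _∪_; ∣_∣; Empty)
  renaming (_-_ to _∖_)
open import Data.Vec using (Vec; []; _∷_; lookup; tabulate)
open import Data.List using (allFin)
open import Data.Bool.ListAction using (any)
open import Data.Rational
  using (ℚ; 0ℚ; 1ℚ; _+_; _-_; _*_; _÷_; _⊔_; _≤_; _<_; Positive; 1/_)
open import Data.Rational.Properties using (pos⇒nonZero; pos+pos⇒pos)
open import Data.Product using (_×_; ∃; Σ)
open import Data.Sum using (_⊎_)
open import Relation.Nullary using (¬_)
open import Relation.Binary.PropositionalEquality using (_≡_; _≢_)

-- Vertices of the graph are Fin m.  The (simple) graph is given by a
-- Boolean adjacency function E; symmetry and irreflexivity are
-- hypotheses of the theorem.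

wsum : ∀ {m} → (Fin m → ℚ) → Subset m → ℚ
wsum f [] = 0ℚ
wsum f (true ∷ X) = f Fin.zero + wsum (λ i → f (Fin.suc i)) X
wsum f (false ∷ X) = wsum (λ i → f (Fin.suc i)) X

wt : ∀ {m} → (Fin m → ℚ) → Subset m → ℚ
wt w X = wsum w X

wt² : ∀ {m} → (Fin m → ℚ) → Subset m → ℚ
wt² w X = wsum (λ x → w x * w x) X

module _ {m : ℕ} (E : Fin m → Fin m → Bool) where

  Adj : Fin m → Fin m → Set
  Adj x y = E x y ≡ true

  Independent : Subset m → Set
  Independent X = ∀ x y → x ∈ X → y ∈ X → E x y ≡ false

  -- (k+1)-claw free: no vertex has k+1 pairwise non-adjacent neighbours
  ClawFree : ℕ → Set
  ClawFree k = ∀ v (S : Subset m) → (∀ x → x ∈ S → Adj v x) →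
               Independent S → ∣ S ∣ ℕ.≤ k

  Nbr : Subset m → Subset m → Subset m
  Nbr A X = tabulate λ a →
    lookup A a ∧ (lookup X a ∨ any (λ x → lookup X x ∧ E x a) (allFin m))

  Nv : Subset m → Fin m → Subset m
  Nv A u = Nbr A ⁅ u ⁆

  module _ (w : Fin m → ℚ) where

    MaxWeightIndependent : Subset m → Set
    MaxWeightIndependent S =
      Independent S × (∀ B → Independent B → wt w B ≤ wt w S)

    LocalImprovement : Subset m → Subset m → Set
    LocalImprovement A X = Independent X × wt² w (Nbr A X) < wt² w X

    ClawShaped : Subset m → Subset m → Set
    ClawShaped A X = (∣ X ∣ ≡ 1 × Empty (Nbr A X))
                   ⊎ ∃ λ v → v ∈ A × (∀ x → x ∈ X → Adj v x)

    NoClawShapedImprovement : Subset m → Set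
    NoClawShapedImprovement A =
      ∀ X → LocalImprovement A X → ¬ ClawShaped A X

    IsN : Subset m → (Fin m → Fin m) → Set
    IsN A n = ∀ u a → a ∈ Nv A u →
      n u ∈ Nv A u × (∀ b → b ∈ Nv A u → w b ≤ w (n u))

    IsN₂ : Subset m → (Fin m → Fin m) → (Fin m → Fin m) → Set
    IsN₂ A n n₂ = ∀ u → 2 ℕ.≤ ∣ Nv A u ∣ →
      n₂ u ∈ Nv A u × n₂ u ≢ n u ×
      (∀ b → b ∈ Nv A u → b ≢ n u → w b ≤ w (n₂ u))

    module _ (wpos : ∀ x → Positive (w x)) (A : Subset m) where

      contr : Fin m → Fin m → ℚ
      contr u v =
        if lookup (Nv A u) v
        then 0ℚ ⊔ ((w u * w u - wt² w (Nv A u ∖ v)) ÷ w v)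
                    {{pos⇒nonZero (w v) {{wpos v}}}}
        else 0ℚ

      module _ (ε : ℚ) (εpos : Positive ε) (n n₂ : Fin m → Fin m) where

        1+ε : ℚ
        1+ε = 1ℚ + ε

        inv1+ε : ℚ
        inv1+ε = (1/ 1+ε) {{pos⇒nonZero 1+ε {{pos+pos⇒pos 1ℚ {{_}} ε {{εpos}}}}}}

        Helpful : Fin m → Fin m → Set
        Helpful u v = u ∉ A × v ∈ A × Adj u v ×
          ( ( v ≡ n u
            × w (n u) ≤ 1+ε * w u
            × wt w (Nv A u ∖ n u) ≤ ε * w u )
          ⊎ ( 2 ℕ.≤ ∣ Nv A u ∣
            × (v ≡ n u ⊎ v ≡ n₂ u)
            × inv1+ε * w (n u) ≤ w (n₂ u)
            × w (n₂ u) ≤ w (n u)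
            × w (n u) ≤ 1+ε * w u
            × wt w ((Nv A u ∖ n u) ∖ n₂ u) ≤ ε * w u ) )

        Special : Subset m → Fin m → Fin m → Set
        Special A* u v = u ∈ A* × v ∈ A × v ≡ n u × ¬ Helpful u v ×
          (+ 5 / 8) * w v < contr u v
          where open import Data.Integer using (+_)
                open import Data.Rational using (_/_)

EpsilonCondition : ℚ → Set
EpsilonCondition ε =
    (+ 3 / 8) * sq (1ℚ + ε) + sq ε ≤ (+ 11 / 16) * sq (1ℚ + ε) + sq ε
  × (+ 11 / 16) * sq (1ℚ + ε) + sq ε ≤ (+ 3 / 4) * sq (1ℚ + ε) + sq ε
  × (+ 3 / 4) * sq (1ℚ + ε) + sq ε ≤ 1ℚ
  where
    open import Data.Integer using (+_)
    open import Data.Rational using (_/_)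
    sq : ℚ → ℚ
    sq x = x * x

{-# OPTIONS --safe #-}
-- Write X = {t₁, u, t₂}, v₁ = n(u), v₂ = n₂(u).  N(X,A) is covered by N(t₁,A) ∖ v₁,
-- N(t₂,A) ∖ v₂ and N(u,A) = {v₁, v₂} ∪ R.  As tᵢ is a special neighbour of vᵢ,
-- contr(tᵢ,vᵢ) > 5/8·w(vᵢ) says w(tᵢ)² > w²(N(tᵢ,A) ∖ vᵢ) + 5/8·w(vᵢ)²; as u is helpful
-- for v₁, both w(vᵢ) ≤ (1+ε)w(u) and w²(R) ≤ w(R)² ≤ ε²w(u)².  Hence
--   w²(N(X,A)) < w(t₁)² + w(t₂)² + 3/8·(w(v₁)² + w(v₂)²) + ε²w(u)²
--              ≤ w(t₁)² + w(t₂)² + (3/4·(1+ε)² + ε²)·w(u)² ≤ w²(X).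
-- X is independent as a subset of A*, and t₁, u, t₂ are distinct because the tᵢ are
-- not helpful for vᵢ while u is, and n(t₁) = v₁ ≠ v₂ = n(t₂).
module Submission where

module TripleImprovement where

  open import Defs
  open import Algebra using (CommutativeMonoid)
  open import Data.Nat using (ℕ)
  open import Data.Bool using (Bool; true; false; T; _∧_)
  open import Data.Bool.Properties using (T-≡; T-∧; T-∨)
  open import Data.Bool.ListAction using (any)
  open import Data.Fin using (Fin; zero; suc; _≟_)
  open import Data.Fin.Subset using (Subset; _∈_; _∉_; _⊆_; ⁅_⁆; _∪_; _∩_; ⊥; Empty)
    renaming (_-_ to _∖_)
  open import Data.Fin.Subset.Properties
    using (Empty-unique; drop-∷-⊆; p─⊥≡p; p─q⊆p; x∈p∪q⁻; x∈p∪q⁺; x∈p∩q⁻; x∈⁅y⁆⇒x≡y;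
           x≢y⇒x∉⁅y⁆; x∈p∧x≢y⇒x∈p-y)
  import Data.Integer as ℤ
  open import Data.List using (allFin)
  import Data.List.Relation.Unary.Any as Any
  open import Data.List.Relation.Unary.Any using (satisfied)
  open import Data.List.Relation.Unary.Any.Properties using (any⁺; any⁻)
  open import Data.List.Membership.Propositional.Properties using (∈-allFin)
  import Data.Product as Product
  open import Data.Product using (_,_; _×_; ∃)
  open import Data.Rational
    using (ℚ; 0ℚ; 1ℚ; _/_; _+_; _-_; _*_; _÷_; 1/_; _⊔_; _≤_; _<_; NonZero; Positive; nonNegative)
  open import Data.Rational.Properties
    using (≤-refl; ≤-trans; ≤-reflexive; <⇒≤; <-irrefl; ≰⇒>; <-≤-trans; ≤-<-trans; ⊔-lub;
           +-assoc; +-comm; +-identityʳ; +-mono-≤; +-monoʳ-≤; +-monoʳ-<; +-mono-<-≤;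
           *-assoc; *-zeroʳ; *-identityˡ; *-identityʳ; *-inverseˡ;
           *-monoˡ-≤-nonNeg; *-monoʳ-≤-nonNeg; *-monoˡ-<-pos;
           positive⁻¹; pos⇒nonZero; +-0-commutativeMonoid; module ≤-Reasoning)
  open import Data.Rational.Solver using (module +-*-Solver)
  import Data.Sum as Sum
  open import Data.Sum using (_⊎_; inj₁; inj₂)
  open import Data.Vec using ([]; _∷_; here; there; lookup)
  open import Data.Vec.Properties using ([]=⇒lookup; lookup⇒[]=; lookup∘tabulate)
  open import Function using (_∘_)
  open import Function.Bundles using (_⇔_; mk⇔; Equivalence)
  open import Relation.Binary.PropositionalEquality
  open import Relation.Nullary using (yes; no; contradiction)
  open import Algebra.Properties.CommutativeSemigroup
    (CommutativeMonoid.commutativeSemigroup +-0-commutativeMonoid)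
    using (interchange; x∙yz≈y∙xz)
  open +-*-Solver

  private
    variable
      m : ℕ

  p≤p+q : ∀ {p q} → 0ℚ ≤ q → p ≤ p + q
  p≤p+q {p} {q} q≥0 = ≤-trans (≤-reflexive (sym (+-identityʳ p))) (+-monoʳ-≤ p q≥0)

  p≤q+p : ∀ {p q} → 0ℚ ≤ q → p ≤ q + p
  p≤q+p {p} {q} q≥0 = ≤-trans (p≤p+q q≥0) (≤-reflexive (+-comm p q))

  nonNeg*nonNeg : ∀ {p q} → 0ℚ ≤ p → 0ℚ ≤ q → 0ℚ ≤ p * q
  nonNeg*nonNeg {p} {q} p≥0 q≥0 =
    ≤-trans (≤-reflexive (sym (*-zeroʳ p))) (*-monoˡ-≤-nonNeg p {{nonNegative p≥0}} q≥0)

  p≤q⇒p*p≤q*q : ∀ {p q} → 0ℚ ≤ p → p ≤ q → p * p ≤ q * q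
  p≤q⇒p*p≤q*q {p} {q} p≥0 p≤q =
    ≤-trans (*-monoˡ-≤-nonNeg p {{nonNegative p≥0}} p≤q)
            (*-monoʳ-≤-nonNeg q {{nonNegative (≤-trans p≥0 p≤q)}} p≤q)

  p÷q*q≡p : ∀ p q .{{_ : NonZero q}} → (p ÷ q) * q ≡ p
  p÷q*q≡p p q = begin
    (p * 1/ q) * q  ≡⟨ *-assoc p (1/ q) q ⟩
    p * (1/ q * q)  ≡⟨ cong (p *_) (*-inverseˡ q) ⟩
    p * 1ℚ          ≡⟨ *-identityʳ p ⟩
    p               ∎
    where open ≡-Reasoning

  c<0⊔q⇒c<q : ∀ {c q} → 0ℚ ≤ c → c < 0ℚ ⊔ q → c < q
  c<0⊔q⇒c<q c≥0 c<0⊔q = ≰⇒> (λ q≤c → <-irrefl refl (<-≤-trans c<0⊔q (⊔-lub c≥0 q≤c)))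

  wsum-nonNeg : (f : Fin m → ℚ) → (∀ i → 0ℚ ≤ f i) → ∀ X → 0ℚ ≤ wsum f X
  wsum-nonNeg f f≥0 [] = ≤-refl
  wsum-nonNeg f f≥0 (true ∷ X) = +-mono-≤ (f≥0 zero) (wsum-nonNeg (f ∘ suc) (f≥0 ∘ suc) X)
  wsum-nonNeg f f≥0 (false ∷ X) = wsum-nonNeg (f ∘ suc) (f≥0 ∘ suc) X

  wsum-⊥ : (f : Fin m → ℚ) → wsum f ⊥ ≡ 0ℚ
  wsum-⊥ {ℕ.zero} f = refl
  wsum-⊥ {ℕ.suc m} f = wsum-⊥ (f ∘ suc)

  wsum-⁅⁆ : (f : Fin m → ℚ) (x : Fin m) → wsum f ⁅ x ⁆ ≡ f x
  wsum-⁅⁆ f zero = trans (cong (f zero +_) (wsum-⊥ (f ∘ suc))) (+-identityʳ (f zero))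
  wsum-⁅⁆ f (suc x) = wsum-⁅⁆ (f ∘ suc) x

  wsum-∪-∩ : (f : Fin m → ℚ) (X Y : Subset m) →
             wsum f (X ∪ Y) + wsum f (X ∩ Y) ≡ wsum f X + wsum f Y
  wsum-∪-∩ f [] [] = refl
  wsum-∪-∩ f (true ∷ X) (true ∷ Y) =
    trans (interchange (f zero) _ (f zero) _)
          (trans (cong (f zero + f zero +_) (wsum-∪-∩ (f ∘ suc) X Y))
                 (interchange (f zero) (f zero) (wsum (f ∘ suc) X) (wsum (f ∘ suc) Y)))
  wsum-∪-∩ f (true ∷ X) (false ∷ Y) =
    trans (+-assoc (f zero) _ _)
          (trans (cong (f zero +_) (wsum-∪-∩ (f ∘ suc) X Y)) (sym (+-assoc (f zero) _ _)))
  wsum-∪-∩ f (false ∷ X) (true ∷ Y) =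
    trans (+-assoc (f zero) _ _)
          (trans (cong (f zero +_) (wsum-∪-∩ (f ∘ suc) X Y))
                 (x∙yz≈y∙xz (f zero) (wsum (f ∘ suc) X) (wsum (f ∘ suc) Y)))
  wsum-∪-∩ f (false ∷ X) (false ∷ Y) = wsum-∪-∩ (f ∘ suc) X Y

  wsum-∪-disjoint : (f : Fin m → ℚ) (X Y : Subset m) → Empty (X ∩ Y) →
                    wsum f (X ∪ Y) ≡ wsum f X + wsum f Y
  wsum-∪-disjoint f X Y X∩Y≡∅ = begin
    wsum f (X ∪ Y)                   ≡⟨ +-identityʳ _ ⟨
    wsum f (X ∪ Y) + 0ℚ              ≡⟨ cong (wsum f (X ∪ Y) +_) (wsum-⊥ f) ⟨
    wsum f (X ∪ Y) + wsum f ⊥        ≡⟨ cong (λ Z → wsum f (X ∪ Y) + wsum f Z) (Empty-unique X∩Y≡∅) ⟨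
    wsum f (X ∪ Y) + wsum f (X ∩ Y)  ≡⟨ wsum-∪-∩ f X Y ⟩
    wsum f X + wsum f Y              ∎
    where open ≡-Reasoning

  wsum-∪-≤ : (f : Fin m → ℚ) → (∀ i → 0ℚ ≤ f i) → (X Y : Subset m) →
             wsum f (X ∪ Y) ≤ wsum f X + wsum f Y
  wsum-∪-≤ f f≥0 X Y = begin
    wsum f (X ∪ Y)                   ≤⟨ p≤p+q (wsum-nonNeg f f≥0 (X ∩ Y)) ⟩
    wsum f (X ∪ Y) + wsum f (X ∩ Y)  ≡⟨ wsum-∪-∩ f X Y ⟩
    wsum f X + wsum f Y              ∎
    where open ≤-Reasoning

  wsum-mono-⊆ : (f : Fin m → ℚ) → (∀ i → 0ℚ ≤ f i) → {X Y : Subset m} → X ⊆ Y →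
                wsum f X ≤ wsum f Y
  wsum-mono-⊆ f f≥0 {[]} {[]} _ = ≤-refl
  wsum-mono-⊆ f f≥0 {true ∷ X} {true ∷ Y} X⊆Y =
    +-monoʳ-≤ (f zero) (wsum-mono-⊆ (f ∘ suc) (f≥0 ∘ suc) (drop-∷-⊆ X⊆Y))
  wsum-mono-⊆ f f≥0 {true ∷ X} {false ∷ Y} X⊆Y with () ← X⊆Y here
  wsum-mono-⊆ f f≥0 {false ∷ X} {true ∷ Y} X⊆Y =
    ≤-trans (wsum-mono-⊆ (f ∘ suc) (f≥0 ∘ suc) (drop-∷-⊆ X⊆Y)) (p≤q+p (f≥0 zero))
  wsum-mono-⊆ f f≥0 {false ∷ X} {false ∷ Y} X⊆Y =
    wsum-mono-⊆ (f ∘ suc) (f≥0 ∘ suc) (drop-∷-⊆ X⊆Y)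

  wsum-remove : (f : Fin m → ℚ) {X : Subset m} {x : Fin m} → x ∈ X →
                wsum f X ≡ f x + wsum f (X ∖ x)
  wsum-remove f {true ∷ X} here = cong (λ Z → f zero + wsum (f ∘ suc) Z) (sym (p─⊥≡p X))
  wsum-remove f {true ∷ X} {suc x} (there x∈X) =
    trans (cong (f zero +_) (wsum-remove (f ∘ suc) x∈X))
          (x∙yz≈y∙xz (f zero) (f (suc x)) (wsum (f ∘ suc) (X ∖ x)))
  wsum-remove f {false ∷ X} (there x∈X) = wsum-remove (f ∘ suc) x∈X

  wsum-sq≤sq-wsum : (f : Fin m → ℚ) → (∀ i → 0ℚ ≤ f i) → ∀ X →
                    wsum (λ i → f i * f i) X ≤ wsum f X * wsum f X
  wsum-sq≤sq-wsum f f≥0 [] = ≤-refl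
  wsum-sq≤sq-wsum f f≥0 (true ∷ X) = begin
    f zero * f zero + wsum (λ i → f (suc i) * f (suc i)) X
      ≤⟨ +-monoʳ-≤ (f zero * f zero) (wsum-sq≤sq-wsum (f ∘ suc) (f≥0 ∘ suc) X) ⟩
    f zero * f zero + S * S
      ≤⟨ p≤p+q (nonNeg*nonNeg (+-mono-≤ (f≥0 zero) (f≥0 zero)) (wsum-nonNeg (f ∘ suc) (f≥0 ∘ suc) X)) ⟩
    (f zero * f zero + S * S) + (f zero + f zero) * S
      ≡⟨ solve 2 (λ a s → (a :* a :+ s :* s) :+ (a :+ a) :* s := (a :+ s) :* (a :+ s)) refl (f zero) S ⟩
    (f zero + S) * (f zero + S) ∎
    where
    open ≤-Reasoning
    S = wsum (f ∘ suc) X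
  wsum-sq≤sq-wsum f f≥0 (false ∷ X) = wsum-sq≤sq-wsum (f ∘ suc) (f≥0 ∘ suc) X

  wsum-⁅⁆∪ : (f : Fin m → ℚ) {x : Fin m} {p : Subset m} → x ∉ p →
             wsum f (⁅ x ⁆ ∪ p) ≡ f x + wsum f p
  wsum-⁅⁆∪ f {x} {p} x∉p = begin
    wsum f (⁅ x ⁆ ∪ p)         ≡⟨ wsum-∪-disjoint f ⁅ x ⁆ p disjoint ⟩
    wsum f ⁅ x ⁆ + wsum f p    ≡⟨ cong (_+ wsum f p) (wsum-⁅⁆ f x) ⟩
    f x + wsum f p             ∎
    where
    open ≡-Reasoning
    disjoint : Empty (⁅ x ⁆ ∩ p)
    disjoint (y , y∈⁅x⁆∩p) with y∈⁅x⁆ , y∈p ← x∈p∩q⁻ ⁅ x ⁆ p y∈⁅x⁆∩p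
      rewrite x∈⁅y⁆⇒x≡y x y∈⁅x⁆ = x∉p y∈p

  wsum-⁅⁆∪⁅⁆∪⁅⁆ : (f : Fin m → ℚ) {x y z : Fin m} → x ≢ y → x ≢ z → y ≢ z →
                 wsum f (⁅ x ⁆ ∪ (⁅ y ⁆ ∪ ⁅ z ⁆)) ≡ f x + (f y + f z)
  wsum-⁅⁆∪⁅⁆∪⁅⁆ f {x} {y} {z} x≢y x≢z y≢z = begin
    wsum f (⁅ x ⁆ ∪ (⁅ y ⁆ ∪ ⁅ z ⁆))  ≡⟨ wsum-⁅⁆∪ f x∉ ⟩
    f x + wsum f (⁅ y ⁆ ∪ ⁅ z ⁆)      ≡⟨ cong (f x +_) (wsum-⁅⁆∪ f (x≢y⇒x∉⁅y⁆ y≢z)) ⟩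
    f x + (f y + wsum f ⁅ z ⁆)        ≡⟨ cong (λ s → f x + (f y + s)) (wsum-⁅⁆ f z) ⟩
    f x + (f y + f z)                 ∎
    where
    open ≡-Reasoning
    x∉ : x ∉ ⁅ y ⁆ ∪ ⁅ z ⁆
    x∉ = Sum.[ x≢y⇒x∉⁅y⁆ x≢y , x≢y⇒x∉⁅y⁆ x≢z ] ∘ x∈p∪q⁻ ⁅ y ⁆ ⁅ z ⁆

  ⁅⁆∪⁅⁆∪⁅⁆⊆ : ∀ {p : Subset m} {x y z} → x ∈ p → y ∈ p → z ∈ p → ⁅ x ⁆ ∪ (⁅ y ⁆ ∪ ⁅ z ⁆) ⊆ p
  ⁅⁆∪⁅⁆∪⁅⁆⊆ {x = x} {y} {z} x∈p y∈p z∈p a∈ with x∈p∪q⁻ ⁅ x ⁆ _ a∈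
  ... | inj₁ a∈⁅x⁆ rewrite x∈⁅y⁆⇒x≡y x a∈⁅x⁆ = x∈p
  ... | inj₂ a∈⁅y⁆∪⁅z⁆ with x∈p∪q⁻ ⁅ y ⁆ ⁅ z ⁆ a∈⁅y⁆∪⁅z⁆
  ...   | inj₁ a∈⁅y⁆ rewrite x∈⁅y⁆⇒x≡y y a∈⁅y⁆ = y∈p
  ...   | inj₂ a∈⁅z⁆ rewrite x∈⁅y⁆⇒x≡y z a∈⁅z⁆ = z∈p

  module _ {m : ℕ} (E : Fin m → Fin m → Bool) where

    Independent-⊆ : ∀ {X Y : Subset m} → Y ⊆ X → Independent E X → Independent E Y
    Independent-⊆ Y⊆X X-indep x y x∈Y y∈Y = X-indep x y (Y⊆X x∈Y) (Y⊆X y∈Y)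

    ∈⇔T-lookup : ∀ (p : Subset m) {x} → x ∈ p ⇔ T (lookup p x)
    ∈⇔T-lookup p = mk⇔ (Equivalence.from T-≡ ∘ []=⇒lookup) (lookup⇒[]= _ _ ∘ Equivalence.to T-≡)

    ∈-Nbr⁻ : ∀ {A X : Subset m} {a} → a ∈ Nbr E A X →
             a ∈ A × (a ∈ X ⊎ ∃ λ x → x ∈ X × Adj E x a)
    ∈-Nbr⁻ {A} {X} {a} a∈N =
      Product.map (Equivalence.from (∈⇔T-lookup A))
                  (Sum.map (Equivalence.from (∈⇔T-lookup X)) (adjacent ∘ satisfied ∘ any⁻ _ (allFin m))
                   ∘ Equivalence.to T-∨)
                  (Equivalence.to T-∧ (subst T (lookup∘tabulate _ a)
                                             (Equivalence.to (∈⇔T-lookup (Nbr E A X)) a∈N)))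
      where
      adjacent : (∃ λ x → T (lookup X x ∧ E x a)) → ∃ λ x → x ∈ X × Adj E x a
      adjacent (x , t) = let tX , tE = Equivalence.to T-∧ t
                         in x , Equivalence.from (∈⇔T-lookup X) tX , Equivalence.to T-≡ tE

    ∈-Nbr⁺ : ∀ {A X : Subset m} {a} → a ∈ A × (a ∈ X ⊎ ∃ λ x → x ∈ X × Adj E x a) →
             a ∈ Nbr E A X
    ∈-Nbr⁺ {A} {X} {a} (a∈A , near) =
      Equivalence.from (∈⇔T-lookup (Nbr E A X)) (subst T (sym (lookup∘tabulate _ a))
        (Equivalence.from T-∧ (Equivalence.to (∈⇔T-lookup A) a∈A ,
          Equivalence.from T-∨ (Sum.map (Equivalence.to (∈⇔T-lookup X)) adjacent near))))
      where
      adjacent : (∃ λ x → x ∈ X × Adj E x a) → T (any (λ x → lookup X x ∧ E x a) (allFin m))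
      adjacent (x , x∈X , x~a) = any⁺ _ (Any.map (λ { refl →
        Equivalence.from T-∧ (Equivalence.to (∈⇔T-lookup X) x∈X , Equivalence.from T-≡ x~a) }) (∈-allFin x))

    Nbr-∪-⊆ : ∀ (A X Y : Subset m) → Nbr E A (X ∪ Y) ⊆ Nbr E A X ∪ Nbr E A Y
    Nbr-∪-⊆ A X Y a∈N with ∈-Nbr⁻ {A} {X ∪ Y} a∈N
    ... | a∈A , inj₁ a∈X∪Y =
      x∈p∪q⁺ (Sum.map (λ a∈X → ∈-Nbr⁺ {A} {X} (a∈A , inj₁ a∈X))
                      (λ a∈Y → ∈-Nbr⁺ {A} {Y} (a∈A , inj₁ a∈Y)) (x∈p∪q⁻ X Y a∈X∪Y))
    ... | a∈A , inj₂ (x , x∈X∪Y , x~a) =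
      x∈p∪q⁺ (Sum.map (λ x∈X → ∈-Nbr⁺ {A} {X} (a∈A , inj₂ (x , x∈X , x~a)))
                      (λ x∈Y → ∈-Nbr⁺ {A} {Y} (a∈A , inj₂ (x , x∈Y , x~a))) (x∈p∪q⁻ X Y x∈X∪Y))

    p⊆p∖x∪q : ∀ {p q : Subset m} {x} → x ∈ q → p ⊆ (p ∖ x) ∪ q
    p⊆p∖x∪q {x = x} x∈q {y} y∈p with y ≟ x
    ... | yes refl = x∈p∪q⁺ (inj₂ x∈q)
    ... | no y≢x = x∈p∪q⁺ (inj₁ (x∈p∧x≢y⇒x∈p-y y∈p y≢x))

    Nbr-triple-⊆ : ∀ {A : Subset m} {t₁ u t₂ v₁ v₂} → v₁ ∈ Nv E A u → v₂ ∈ Nv E A u →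
                   Nbr E A (⁅ t₁ ⁆ ∪ (⁅ u ⁆ ∪ ⁅ t₂ ⁆))
                     ⊆ (Nv E A t₁ ∖ v₁) ∪ ((Nv E A t₂ ∖ v₂) ∪ Nv E A u)
    Nbr-triple-⊆ {A} {t₁} {u} {t₂} v₁∈ v₂∈ a∈N
      with x∈p∪q⁻ _ _ (Nbr-∪-⊆ A ⁅ t₁ ⁆ (⁅ u ⁆ ∪ ⁅ t₂ ⁆) a∈N)
    ... | inj₁ a∈N₁ with x∈p∪q⁻ _ _ (p⊆p∖x∪q v₁∈ a∈N₁)
    ...   | inj₁ a∈D₁ = x∈p∪q⁺ (inj₁ a∈D₁)
    ...   | inj₂ a∈Nu = x∈p∪q⁺ (inj₂ (x∈p∪q⁺ (inj₂ a∈Nu)))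
    Nbr-triple-⊆ {A} {t₁} {u} {t₂} v₁∈ v₂∈ a∈N
        | inj₂ a∈N' with x∈p∪q⁻ _ _ (Nbr-∪-⊆ A ⁅ u ⁆ ⁅ t₂ ⁆ a∈N')
    ...   | inj₁ a∈Nu = x∈p∪q⁺ (inj₂ (x∈p∪q⁺ (inj₂ a∈Nu)))
    ...   | inj₂ a∈N₂ = x∈p∪q⁺ (inj₂ (p⊆p∖x∪q v₂∈ a∈N₂))

  three-eighths-squares≤ : ∀ {ε a v₁ v₂ Q} →
    (ℤ.+ 3 / 4) * ((1ℚ + ε) * (1ℚ + ε)) + ε * ε ≤ 1ℚ → 0ℚ ≤ a →
    0ℚ ≤ v₁ → v₁ ≤ (1ℚ + ε) * a → 0ℚ ≤ v₂ → v₂ ≤ (1ℚ + ε) * a → Q ≤ (ε * a) * (ε * a) →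
    (ℤ.+ 3 / 8) * (v₁ * v₁) + (ℤ.+ 3 / 8) * (v₂ * v₂) + Q ≤ a * a
  three-eighths-squares≤ {ε} {a} {v₁} {v₂} {Q} ε-small a≥0 v₁≥0 v₁≤ v₂≥0 v₂≤ Q≤ = begin
    (ℤ.+ 3 / 8) * (v₁ * v₁) + (ℤ.+ 3 / 8) * (v₂ * v₂) + Q
      ≤⟨ +-mono-≤ (+-mono-≤ (*-monoˡ-≤-nonNeg (ℤ.+ 3 / 8) (p≤q⇒p*p≤q*q v₁≥0 v₁≤))
                            (*-monoˡ-≤-nonNeg (ℤ.+ 3 / 8) (p≤q⇒p*p≤q*q v₂≥0 v₂≤))) Q≤ ⟩
    (ℤ.+ 3 / 8) * (B * B) + (ℤ.+ 3 / 8) * (B * B) + (ε * a) * (ε * a)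
      ≡⟨ solve 2 (λ ε a → con (ℤ.+ 3 / 8) :* (((con 1ℚ :+ ε) :* a) :* ((con 1ℚ :+ ε) :* a))
                          :+ con (ℤ.+ 3 / 8) :* (((con 1ℚ :+ ε) :* a) :* ((con 1ℚ :+ ε) :* a))
                          :+ (ε :* a) :* (ε :* a)
                        := (con (ℤ.+ 3 / 4) :* ((con 1ℚ :+ ε) :* (con 1ℚ :+ ε)) :+ ε :* ε) :* (a :* a))
               refl ε a ⟩
    ((ℤ.+ 3 / 4) * ((1ℚ + ε) * (1ℚ + ε)) + ε * ε) * (a * a)
      ≤⟨ *-monoʳ-≤-nonNeg (a * a) {{nonNegative (nonNeg*nonNeg a≥0 a≥0)}} ε-small ⟩
    1ℚ * (a * a)
      ≡⟨ *-identityˡ (a * a) ⟩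
    a * a ∎
    where
    open ≤-Reasoning
    B = (1ℚ + ε) * a

  squares-<-improvement : ∀ {N S₁ S₂ v₁ v₂ Q a T₁ T₂} →
    N ≤ S₁ + (S₂ + (v₁ * v₁ + (v₂ * v₂ + Q))) →
    (ℤ.+ 3 / 8) * (v₁ * v₁) + (ℤ.+ 3 / 8) * (v₂ * v₂) + Q ≤ a * a →
    S₁ + ((ℤ.+ 5 / 8) * v₁) * v₁ < T₁ → S₂ + ((ℤ.+ 5 / 8) * v₂) * v₂ < T₂ →
    N < T₁ + (a * a + T₂)
  squares-<-improvement {N} {S₁} {S₂} {v₁} {v₂} {Q} {a} {T₁} {T₂} N≤ leftover≤ gain₁ gain₂ = begin-strict
    N
      ≤⟨ N≤ ⟩
    S₁ + (S₂ + (v₁ * v₁ + (v₂ * v₂ + Q)))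
      ≡⟨ solve 5 (λ S₁ S₂ v₁ v₂ Q →
               S₁ :+ (S₂ :+ (v₁ :* v₁ :+ (v₂ :* v₂ :+ Q)))
            := (S₁ :+ (con (ℤ.+ 5 / 8) :* v₁) :* v₁)
               :+ ((con (ℤ.+ 3 / 8) :* (v₁ :* v₁) :+ con (ℤ.+ 3 / 8) :* (v₂ :* v₂) :+ Q)
                   :+ (S₂ :+ (con (ℤ.+ 5 / 8) :* v₂) :* v₂)))
           refl S₁ S₂ v₁ v₂ Q ⟩
    (S₁ + ((ℤ.+ 5 / 8) * v₁) * v₁)
      + (((ℤ.+ 3 / 8) * (v₁ * v₁) + (ℤ.+ 3 / 8) * (v₂ * v₂) + Q) + (S₂ + ((ℤ.+ 5 / 8) * v₂) * v₂))
      <⟨ +-mono-<-≤ gain₁ (+-mono-≤ leftover≤ (<⇒≤ gain₂)) ⟩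
    T₁ + (a * a + T₂) ∎
    where open ≤-Reasoning

  module _ {m : ℕ} (E : Fin m → Fin m → Bool) (w : Fin m → ℚ) (wpos : ∀ x → Positive (w x))
           (A : Subset m) where

    w≥0 : ∀ x → 0ℚ ≤ w x
    w≥0 x = <⇒≤ (positive⁻¹ (w x) {{wpos x}})

    w²≥0 : ∀ x → 0ℚ ≤ w x * w x
    w²≥0 x = nonNeg*nonNeg (w≥0 x) (w≥0 x)

    contr-bound : ∀ t v {c} → 0ℚ ≤ c → c < contr E w wpos A t v →
                  wt² w (Nv E A t ∖ v) + c * w v < w t * w t
    contr-bound t v {c} c≥0 c<contr with lookup (Nv E A t) v
    ... | false = contradiction (≤-<-trans c≥0 c<contr) (<-irrefl refl)
    ... | true = begin-strict
      S + c * w v       <⟨ +-monoʳ-< S (*-monoˡ-<-pos (w v) {{wpos v}} (c<0⊔q⇒c<q {q = D ÷ w v} c≥0 c<contr)) ⟩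
      S + (D ÷ w v) * w v ≡⟨ cong (S +_) (p÷q*q≡p D (w v)) ⟩
      S + (w t * w t - S) ≡⟨ solve 2 (λ S W → S :+ (W :- S) := W) refl S (w t * w t) ⟩
      w t * w t         ∎
      where
      open ≤-Reasoning
      S = wt² w (Nv E A t ∖ v)
      D = w t * w t - S
      instance
        w-v≢0 : NonZero (w v)
        w-v≢0 = pos⇒nonZero (w v) {{wpos v}}

    module _ (ε : ℚ) (εpos : Positive ε) (n n₂ : Fin m → Fin m) where

      helpful⇒w-n≤ : ∀ {u v} → Helpful E w wpos A ε εpos n n₂ u v → w (n u) ≤ (1ℚ + ε) * w u
      helpful⇒w-n≤ (_ , _ , _ , inj₁ (_ , w-n≤ , _)) = w-n≤
      helpful⇒w-n≤ (_ , _ , _ , inj₂ (_ , _ , _ , _ , w-n≤ , _)) = w-n≤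

      helpful⇒w-rest≤ : ∀ {u v} → Helpful E w wpos A ε εpos n n₂ u v →
                        wt w (Nv E A u ∖ n u ∖ n₂ u) ≤ ε * w u
      helpful⇒w-rest≤ {u} (_ , _ , _ , inj₁ (_ , _ , rest≤)) =
        ≤-trans (wsum-mono-⊆ w w≥0 (p─q⊆p (Nv E A u ∖ n u) ⁅ n₂ u ⁆)) rest≤
      helpful⇒w-rest≤ (_ , _ , _ , inj₂ (_ , _ , _ , _ , _ , rest≤)) = rest≤

      wt²-Nbr<wt²-triple :
        (ℤ.+ 3 / 4) * ((1ℚ + ε) * (1ℚ + ε)) + ε * ε ≤ 1ℚ →
        ∀ {u t₁ t₂} → n u ∈ Nv E A u → n₂ u ∈ Nv E A u → n₂ u ≢ n u → w (n₂ u) ≤ w (n u) →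
        Helpful E w wpos A ε εpos n n₂ u (n u) →
        (ℤ.+ 5 / 8) * w (n u) < contr E w wpos A t₁ (n u) →
        (ℤ.+ 5 / 8) * w (n₂ u) < contr E w wpos A t₂ (n₂ u) →
        t₁ ≢ u → t₁ ≢ t₂ → u ≢ t₂ →
        wt² w (Nbr E A (⁅ t₁ ⁆ ∪ (⁅ u ⁆ ∪ ⁅ t₂ ⁆))) < wt² w (⁅ t₁ ⁆ ∪ (⁅ u ⁆ ∪ ⁅ t₂ ⁆))
      wt²-Nbr<wt²-triple ε-small {u} {t₁} {t₂} v₁∈ v₂∈ v₂≢v₁ w-v₂≤ helpful contr₁ contr₂
                         t₁≢u t₁≢t₂ u≢t₂ =
        begin-strict
          wt² w (Nbr E A (⁅ t₁ ⁆ ∪ (⁅ u ⁆ ∪ ⁅ t₂ ⁆)))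
            <⟨ squares-<-improvement {S₁ = wt² w D₁} {wt² w D₂} {w v₁} {w v₂} {wt² w R} {w u} N≤
                 (three-eighths-squares≤ {ε} {w u} ε-small (w≥0 u) (w≥0 v₁) w-v₁≤ (w≥0 v₂)
                                         (≤-trans w-v₂≤ w-v₁≤) rest≤)
                 (contr-bound t₁ v₁ (five-eighths≥0 v₁) contr₁)
                 (contr-bound t₂ v₂ (five-eighths≥0 v₂) contr₂) ⟩
          w t₁ * w t₁ + (w u * w u + w t₂ * w t₂)
            ≡⟨ wsum-⁅⁆∪⁅⁆∪⁅⁆ _ t₁≢u t₁≢t₂ u≢t₂ ⟨
          wt² w (⁅ t₁ ⁆ ∪ (⁅ u ⁆ ∪ ⁅ t₂ ⁆)) ∎
        where
        open ≤-Reasoning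
        v₁ = n u
        v₂ = n₂ u
        D₁ = Nv E A t₁ ∖ v₁
        D₂ = Nv E A t₂ ∖ v₂
        R = Nv E A u ∖ v₁ ∖ v₂
        w-v₁≤ = helpful⇒w-n≤ helpful
        five-eighths≥0 : ∀ x → 0ℚ ≤ (ℤ.+ 5 / 8) * w x
        five-eighths≥0 x = nonNeg*nonNeg (<⇒≤ (positive⁻¹ (ℤ.+ 5 / 8))) (w≥0 x)
        rest≤ : wt² w R ≤ (ε * w u) * (ε * w u)
        rest≤ = ≤-trans (wsum-sq≤sq-wsum w w≥0 R)
                        (p≤q⇒p*p≤q*q (wsum-nonNeg w w≥0 R) (helpful⇒w-rest≤ helpful))
        N≤ : wt² w (Nbr E A (⁅ t₁ ⁆ ∪ (⁅ u ⁆ ∪ ⁅ t₂ ⁆)))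
               ≤ wt² w D₁ + (wt² w D₂ + (w v₁ * w v₁ + (w v₂ * w v₂ + wt² w R)))
        N≤ = begin
          wt² w (Nbr E A (⁅ t₁ ⁆ ∪ (⁅ u ⁆ ∪ ⁅ t₂ ⁆)))
            ≤⟨ wsum-mono-⊆ _ w²≥0 (Nbr-triple-⊆ E {A} {t₁} {u} {t₂} v₁∈ v₂∈) ⟩
          wt² w (D₁ ∪ (D₂ ∪ Nv E A u))
            ≤⟨ wsum-∪-≤ _ w²≥0 D₁ (D₂ ∪ Nv E A u) ⟩
          wt² w D₁ + wt² w (D₂ ∪ Nv E A u)
            ≤⟨ +-monoʳ-≤ (wt² w D₁) (wsum-∪-≤ _ w²≥0 D₂ (Nv E A u)) ⟩
          wt² w D₁ + (wt² w D₂ + wt² w (Nv E A u))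
            ≡⟨ cong (λ s → wt² w D₁ + (wt² w D₂ + s))
                    (trans (wsum-remove _ v₁∈) (cong (w v₁ * w v₁ +_)
                           (wsum-remove _ (x∈p∧x≢y⇒x∈p-y v₂∈ v₂≢v₁)))) ⟩
          wt² w D₁ + (wt² w D₂ + (w v₁ * w v₁ + (w v₂ * w v₂ + wt² w R))) ∎


open import Defs
open import Data.Nat using (ℕ; _≤_)
open import Data.Bool using (Bool; false)
open import Data.Fin using (Fin)
open import Data.Fin.Subset using (Subset; _∈_; _∉_; ⁅_⁆; _∪_; ∣_∣)
open import Data.Product using (_,_; proj₁; proj₂)
open import Data.Rational using (ℚ; Positive; _<_)
open import Relation.Binary.PropositionalEquality

open TripleImprovement using (Independent-⊆; ⁅⁆∪⁅⁆∪⁅⁆⊆; wt²-Nbr<wt²-triple)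

lemma15 : (k : ℕ) → 4 ≤ k →
    (m : ℕ) (E : Fin m → Fin m → Bool) →
    (∀ x y → E x y ≡ E y x) → (∀ x → E x x ≡ false) →
    ClawFree E k →
    (w : Fin m → ℚ) (wpos : ∀ x → Positive (w x)) →
    (A* A : Subset m) →
    MaxWeightIndependent E w A* →
    Independent E A →
    NoClawShapedImprovement E w A →
    (ε : ℚ) (εpos : Positive ε) → EpsilonCondition ε →
    (n n₂ : Fin m → Fin m) → IsN E w A n → IsN₂ E w A n n₂ →
    (u : Fin m) → u ∈ A* → u ∉ A → 2 ≤ ∣ Nv E A u ∣ →
    n u ∉ A* → n₂ u ∉ A* →
    (t₁ t₂ : Fin m) →
    Special E w wpos A ε εpos n n₂ A* t₁ (n u) →
    Special E w wpos A ε εpos n n₂ A* t₂ (n₂ u) →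
    Helpful E w wpos A ε εpos n n₂ u (n u) →
    Helpful E w wpos A ε εpos n n₂ u (n₂ u) →
    LocalImprovement E w A (⁅ t₁ ⁆ ∪ (⁅ u ⁆ ∪ ⁅ t₂ ⁆))
lemma15 _ _ _ E _ _ _ w wpos A* A (A*-indep , _) _ _ ε εpos (_ , _ , ε-small) n n₂ isN isN₂
        u u∈A* _ two-nbrs _ _ t₁ t₂
        (t₁∈A* , _ , nu≡nt₁ , t₁-unhelpful , contr₁) (t₂∈A* , _ , n₂u≡nt₂ , t₂-unhelpful , contr₂)
        u-helpful₁ u-helpful₂ =
  Independent-⊆ E (⁅⁆∪⁅⁆∪⁅⁆⊆ t₁∈A* u∈A* t₂∈A*) A*-indep ,
  wt²-Nbr<wt²-triple E w wpos A ε εpos n n₂ ε-small nu∈ n₂u∈ n₂u≢nu (nu-max (n₂ u) n₂u∈)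
                     u-helpful₁ contr₁ contr₂ t₁≢u t₁≢t₂ u≢t₂
  where
  n₂u∈ = proj₁ (isN₂ u two-nbrs)
  n₂u≢nu = proj₁ (proj₂ (isN₂ u two-nbrs))
  nu∈ = proj₁ (isN u (n₂ u) n₂u∈)
  nu-max = proj₂ (isN u (n₂ u) n₂u∈)
  t₁≢u : t₁ ≢ u
  t₁≢u refl = t₁-unhelpful u-helpful₁
  u≢t₂ : u ≢ t₂
  u≢t₂ refl = t₂-unhelpful u-helpful₂
  t₁≢t₂ : t₁ ≢ t₂
  t₁≢t₂ refl = n₂u≢nu (trans n₂u≡nt₂ (sym nu≡nt₁))
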